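{- Let $n\ge1$ and let $a_1,\dots,a_n$ be integers with $a_1\ge1$ and $a_i\ge2$ for $i=2,\dots,n$. Then \[ T(S(a_1,\dots,a_n);1,1)=\sum_{b\in\mathrm{Fib}(n+1)}\prod_{i=1}^n (a_i-1)^{1-|b_{i+1}-b_i|}, \] with the convention $0^0=1$. Furthermore, for $n>1$ with $(n,a_1)\neq(2,1)$, \[ T(S(a_1,\dots,a_n);1,1)=T(S(a_1,\dots,a_{n-1});1,1)+(a_n-1)\cdot T(S(a_1,\dots,a_{n-2},a_{n-1}-1);1,1), \] where $S(a_1,\dots,a_{n-2},a_{n-1}-1)$ is interpreted as $S(a_1,\dots,a_{n-2})$ when $a_{n-1}=2$ and $n>2$.
   Context: $T(M;1,1)$ is the Tutte polynomial evaluated at $(1,1)$, i.e. the number of bases of $M$. $\mathrm{Fib}(k)$ is the set of binary sequences $b=(b_1,\dots,b_k)\in\{0,1\}^k$ with no two adjacent $1$'s. Lattice path matroids: for lattice paths $P,Q$ (steps $N=(0,1)$, $E=(1,0)$) from $(0,0)$ to $(m,r)$ with $P$ never above $Q$, $M[P,Q]$ is the matroid on $\{1,\dots,m+r\}$ whose bases are the $r$-subsets $B$ such that the lattice path with North steps exactly at the positions in $B$ stays in the closed region (diagram) bounded by $P$ and $Q$. Snakes: an LPM is a snake if it has at least two elements, is connected, and its diagram has no interior lattice points. For $a_1\ge1$, $a_i\ge2$ ($i\ge2$), $S(a_1,\dots,a_n)$ is the snake whose diagram, starting at the origin, consists of $a_1$ unit squares in a row to the right, then $a_2$ squares up, then $a_3$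 to the right, alternating up to $a_n$, where the last square of each group is the first square of the next. $S(1)$ (one square) is the trivial snake. -}

module Defs where

open import Data.Bool using (Bool; true; false)
open import Data.Nat using (ℕ; zero; suc; _+_; _*_; _∸_; _^_; _≤_; ∣_-_∣)
open import Data.Nat.Properties using (_≤?_; _≟_)
open import Data.List using (List; []; _∷_; _++_; length; take; drop; zip; zipWith;
  replicate; filter; map; upTo; concatMap)
open import Data.Nat.ListAction using (sum; product)
open import Data.List.Relation.Unary.All using (All; all?)
open import Data.Vec using (Vec; toList) renaming ([] to []ᵥ; _∷_ to _∷ᵥ_)
open import Data.Fin.Subset using (Subset)
open import Data.Product using (_×_; proj₁; proj₂)
open import Relation.Binary.PropositionalEquality using (_≡_)
open import Relation.Nullary using (¬_; Dec; yes; no)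
open import Relation.Nullary.Decidable using (_×-dec_; ¬?)
import Data.Bool.Properties as BoolP

-- Lattice paths: a path is a list of steps, true = N = (0,1), false = E = (1,0).

#N : List Bool → ℕ
#N []           = 0
#N (true  ∷ xs) = suc (#N xs)
#N (false ∷ xs) = #N xs

heightAt : List Bool → ℕ → ℕ
heightAt xs k = #N (take k xs)

-- Lattice path matroid M[P,Q] (P the lower and Q the upper bounding path,
-- both from (0,0) to (m,r), so of length m + r).  Ground set {1,…,m+r} is
-- represented by Fin (length P); a subset B is a Subset (Vec Bool), and the
-- lattice path with North steps exactly at the positions of B is toList B.
-- That path stays in the closed region between P and Q iff after every
-- number k of steps its height lies between the heights of P and Q.

StaysBetween : (P Q X : List Bool) → Set
StaysBetween P Q X =
  All (λ k → (heightAt P k ≤ heightAt X k) × (heightAt X k ≤ heightAt Q k))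
      (upTo (suc (length P)))

IsBasis : (P Q : List Bool) → Subset (length P) → Set
IsBasis P Q B = (#N (toList B) ≡ #N P) × StaysBetween P Q (toList B)

isBasis? : (P Q : List Bool) (B : Subset (length P)) → Dec (IsBasis P Q B)
isBasis? P Q B =
  (#N (toList B) ≟ #N P) ×-dec
  all? (λ k → (heightAt P k ≤? heightAt (toList B) k) ×-dec
              (heightAt (toList B) k ≤? heightAt Q k))
       (upTo (suc (length P)))

allSubsets : (n : ℕ) → List (Subset n)
allSubsets zero    = []ᵥ ∷ []
allSubsets (suc n) = concatMap (λ s → (false ∷ᵥ s) ∷ (true ∷ᵥ s) ∷ []) (allSubsets n)

bases : (P Q : List Bool) → List (Subset (length P))
bases P Q = filter (isBasis? P Q) (allSubsets (length P))

-- T(M[P,Q];1,1) = number of bases of M[P,Q]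
T11 : (P Q : List Bool) → ℕ
T11 P Q = length (bases P Q)

-- The diagram is a ribbon of unit squares; walking from
-- the square at the origin, consecutive squares are reached by moves
-- Right (a₁-1 times), Up (a₂-1 times), Right (a₃-1 times), … .
-- With Right ↦ E and Up ↦ N, the move word w gives the bounding paths
--   lower P = E w N,   upper Q = N w E.

-- move word; the Bool says whether the current group is horizontal
snakeMovesFrom : Bool → List ℕ → List Bool
snakeMovesFrom horiz []       = []
snakeMovesFrom true  (a ∷ as) = replicate (a ∸ 1) false ++ snakeMovesFrom false as
snakeMovesFrom false (a ∷ as) = replicate (a ∸ 1) true  ++ snakeMovesFrom true  as

snakeMoves : List ℕ → List Bool
snakeMoves = snakeMovesFrom true

snakeLower : List ℕ → List Bool
snakeLower as = false ∷ (snakeMoves as ++ true ∷ [])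

snakeUpper : List ℕ → List Bool
snakeUpper as = true ∷ (snakeMoves as ++ false ∷ [])

snakeT11 : List ℕ → ℕ
snakeT11 as = T11 (snakeLower as) (snakeUpper as)

data ValidSnakeSeq : List ℕ → Set where
  valid : ∀ {a₁ as} → 1 ≤ a₁ → All (λ a → 2 ≤ a) as → ValidSnakeSeq (a₁ ∷ as)

bitsOf : ℕ → List (List Bool)
bitsOf zero    = [] ∷ []
bitsOf (suc k) = concatMap (λ s → (false ∷ s) ∷ (true ∷ s) ∷ []) (bitsOf k)

adjPairs : List Bool → List (Bool × Bool)
adjPairs b = zip b (drop 1 b)

NoAdjOnes : List Bool → Set
NoAdjOnes b = All (λ p → ¬ ((proj₁ p ≡ true) × (proj₂ p ≡ true))) (adjPairs b)

noAdjOnes? : (b : List Bool) → Dec (NoAdjOnes b)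
noAdjOnes? b = all? (λ p → ¬? ((proj₁ p BoolP.≟ true) ×-dec (proj₂ p BoolP.≟ true))) (adjPairs b)

Fib : ℕ → List (List Bool)
Fib k = filter noAdjOnes? (bitsOf k)

bit : Bool → ℕ
bit true  = 1
bit false = 0

-- ∏_{i=1}^n (aᵢ - 1)^{1 - |b_{i+1} - bᵢ|}   (Agda's 0 ^ 0 = 1)
fibTerm : List ℕ → List Bool → ℕ
fibTerm as b =
  product (zipWith (λ a p → (a ∸ 1) ^ (1 ∸ ∣ bit (proj₂ p) - bit (proj₁ p) ∣)) as (adjPairs b))

fibSum : List ℕ → ℕ
fibSum as = sum (map (fibTerm as) (Fib (suc (length as))))

-- The sequence (a₁,…,a_{n-2}, a_{n-1}-1), read as (a₁,…,a_{n-2}) when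
-- a_{n-1} = 2 and n > 2.  Here the prefix (a₁,…,a_{n-2}) is `as`, x = a_{n-1}.
reducedSeq : List ℕ → ℕ → List ℕ
reducedSeq []         x = (x ∸ 1) ∷ []
reducedSeq as@(_ ∷ _) x with x ≟ 2
... | yes _ = as
... | no  _ = as ++ (x ∸ 1) ∷ []

-- A basis of M[P,Q] is a lattice path in the diagram, and such paths are counted
-- step by step from the heights of P, X and Q.  The diagram of a snake is a ribbon
-- one square wide, so after its first step the path is always at the lower or the
-- upper corner of a square, and the pair of completion counts from the two corners
-- evolves linearly: a group of a squares followed by a turn acts as the matrix
-- M(a) = [[a-1, 1], [1, 0]].  Hence T(S(a₁,…,aₙ);1,1) is the sum of the entries of
-- M(a₁)⋯M(aₙ)(1,1), for every list of parameters.  Expanding this product, the term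
-- indexed by b ∈ {0,1}ⁿ⁺¹ is ∏ M(a_i)[b_i, b_{i+1}], which is 0 when b has two
-- adjacent 1's and ∏ (a_i - 1)^{1-|b_{i+1}-b_i|} otherwise.  The recurrence is
-- linearity of the product together with an identity for its last two factors,
-- valid when a_{n-1} ≥ 2.

module Submission where

open import Defs
open import Data.Bool using (Bool; true; false; _∧_; if_then_else_)
open import Data.Bool.Properties using (∧-assoc; ∧-comm; ∧-identityʳ)
open import Data.Bool.ListAction using (and; all)
open import Data.Empty using (⊥-elim)
open import Data.List using (List; []; _∷_; _++_; length; map; filter; foldr; replicate;
  upTo; concatMap; take)
open import Data.List.Properties using (map-cong; map-applyUpTo; map-upTo; foldr-++; length-++)
open import Data.List.Relation.Unary.All using (all?; head)
open import Data.List.Relation.Unary.All.Properties using (++⁻ʳ)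
open import Data.Nat using (ℕ; zero; suc; _+_; _*_; _∸_; _≤_; s≤s; s≤s⁻¹; z≤n)
open import Data.Nat.ListAction using (sum)
open import Data.Nat.Properties using (_≤?_; _≟_; +-identityʳ; +-assoc; +-comm; *-zeroʳ;
  +-suc; *-distribˡ-+; suc-injective; +-commutativeSemigroup)
open import Algebra.Properties.CommutativeSemigroup +-commutativeSemigroup using (interchange)
open import Data.Nat.Tactic.RingSolver using (solve-∀)
open import Data.Product using (_×_; _,_; proj₁; proj₂; swap)
open import Data.Vec using (toList) renaming (_∷_ to _∷ᵥ_)
open import Data.Vec.Properties using (length-toList)
open import Function using (_∘_)
open import Function.Bundles using (mk⇔)
open import Relation.Binary.PropositionalEquality
open ≡-Reasoning
open import Relation.Nullary using (¬_; does; yes; no)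
open import Relation.Nullary.Decidable using (does-⇔; _×-dec_)
open import Relation.Unary using (Decidable)

sum-map-filter : ∀ {a p} {A : Set a} {P : A → Set p} (P? : Decidable P) (f : A → ℕ) xs →
  sum (map f (filter P? xs)) ≡ sum (map (λ x → bit (does (P? x)) * f x) xs)
sum-map-filter P? f [] = refl
sum-map-filter P? f (x ∷ xs) with does (P? x)
... | true  = cong₂ _+_ (sym (+-identityʳ (f x))) (sum-map-filter P? f xs)
... | false = sum-map-filter P? f xs

length-filter≡sum : ∀ {a p} {A : Set a} {P : A → Set p} (P? : Decidable P) xs →
  length (filter P? xs) ≡ sum (map (λ x → bit (does (P? x))) xs)
length-filter≡sum P? [] = refl
length-filter≡sum P? (x ∷ xs) with does (P? x)
... | true  = cong suc (length-filter≡sum P? xs)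
... | false = length-filter≡sum P? xs

sum-map-concatMap-pair : ∀ {a b} {A : Set a} {B : Set b} (g : B → ℕ) (f h : A → B) xs →
  sum (map g (concatMap (λ x → f x ∷ h x ∷ []) xs)) ≡ sum (map (g ∘ f) xs) + sum (map (g ∘ h) xs)
sum-map-concatMap-pair g f h [] = refl
sum-map-concatMap-pair g f h (x ∷ xs) = begin
    g (f x) + (g (h x) + sum (map g (concatMap (λ x → f x ∷ h x ∷ []) xs)))
  ≡⟨ cong (λ s → g (f x) + (g (h x) + s)) (sum-map-concatMap-pair g f h xs) ⟩
    g (f x) + (g (h x) + (sum (map (g ∘ f) xs) + sum (map (g ∘ h) xs)))
  ≡⟨ sym (+-assoc (g (f x)) _ _) ⟩
    (g (f x) + g (h x)) + (sum (map (g ∘ f) xs) + sum (map (g ∘ h) xs))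
  ≡⟨ interchange (g (f x)) _ _ _ ⟩
    (g (f x) + sum (map (g ∘ f) xs)) + (g (h x) + sum (map (g ∘ h) xs)) ∎

sum-map-scale : ∀ {a} {A : Set a} k (f : A → ℕ) xs →
  sum (map (λ x → k * f x) xs) ≡ k * sum (map f xs)
sum-map-scale k f [] = sym (*-zeroʳ k)
sum-map-scale k f (x ∷ xs) =
  trans (cong (k * f x +_) (sum-map-scale k f xs)) (sym (*-distribˡ-+ k (f x) _))

sum-map-zero : ∀ {a} {A : Set a} {f : A → ℕ} → (∀ x → f x ≡ 0) → ∀ xs → sum (map f xs) ≡ 0
sum-map-zero f≡0 [] = refl
sum-map-zero f≡0 (x ∷ xs) = cong₂ _+_ (f≡0 x) (sum-map-zero f≡0 xs)

does-all? : ∀ {a p} {A : Set a} {P : A → Set p} (P? : Decidable P) xs →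
  does (all? P? xs) ≡ all (does ∘ P?) xs
does-all? P? [] = refl
does-all? P? (x ∷ xs) = cong (does (P? x) ∧_) (does-all? P? xs)

all-upTo-suc : ∀ (g : ℕ → Bool) n → all g (upTo (suc n)) ≡ g 0 ∧ all (g ∘ suc) (upTo n)
all-upTo-suc g n =
  cong (λ bs → g 0 ∧ and bs) (trans (map-applyUpTo suc g n) (sym (map-upTo (g ∘ suc) n)))

within : ℕ → ℕ → ℕ → Bool
within hp hx hq = does (hp ≤? hx) ∧ does (hx ≤? hq)

within-cong : ∀ {hp hx hq hp′ hx′ hq′} → hp ≡ hp′ → hx ≡ hx′ → hq ≡ hq′ →
  within hp hx hq ≡ within hp′ hx′ hq′
within-cong refl refl refl = refl

within-suc : ∀ hp hx hq → within (suc hp) (suc hx) (suc hq) ≡ within hp hx hq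
within-suc hp hx hq = cong₂ _∧_ (suc≤?suc hp hx) (suc≤?suc hx hq)
  where
  suc≤?suc : ∀ m n → does (suc m ≤? suc n) ≡ does (m ≤? n)
  suc≤?suc m n = does-⇔ (mk⇔ s≤s⁻¹ s≤s) (suc m ≤? suc n) (m ≤? n)

heightAfter : Bool → ℕ → ℕ
heightAfter true  h = suc h
heightAfter false h = h

heightAfter-suc : ∀ p h → heightAfter p (suc h) ≡ suc (heightAfter p h)
heightAfter-suc true  h = refl
heightAfter-suc false h = refl

+-#N-∷ : ∀ h p xs → h + #N (p ∷ xs) ≡ heightAfter p h + #N xs
+-#N-∷ h true  xs = +-suc h (#N xs)
+-#N-∷ h false xs = refl

-- hp, hx, hq are the current heights of P, X, Q.
between : ℕ → ℕ → ℕ → List Bool → List Bool → List Bool → Bool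
between hp hx hq []      []      []      = within hp hx hq ∧ does (hx ≟ hp)
between hp hx hq (p ∷ P) (q ∷ Q) (x ∷ X) =
  within hp hx hq ∧ between (heightAfter p hp) (heightAfter x hx) (heightAfter q hq) P Q X
between _ _ _ _ _ _ = false

withinAt : ℕ → ℕ → ℕ → List Bool → List Bool → List Bool → ℕ → Bool
withinAt hp hx hq P Q X k = within (hp + heightAt P k) (hx + heightAt X k) (hq + heightAt Q k)

isBasisFrom : ℕ → ℕ → ℕ → List Bool → List Bool → List Bool → Bool
isBasisFrom hp hx hq P Q X =
  all (withinAt hp hx hq P Q X) (upTo (suc (length P))) ∧ does ((hx + #N X) ≟ (hp + #N P))

withinAt-zero : ∀ hp hx hq P Q X → withinAt hp hx hq P Q X 0 ≡ within hp hx hq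
withinAt-zero hp hx hq P Q X = within-cong (+-identityʳ hp) (+-identityʳ hx) (+-identityʳ hq)

withinAt-suc : ∀ hp hx hq p P q Q x X k →
  withinAt hp hx hq (p ∷ P) (q ∷ Q) (x ∷ X) (suc k)
  ≡ withinAt (heightAfter p hp) (heightAfter x hx) (heightAfter q hq) P Q X k
withinAt-suc hp hx hq p P q Q x X k =
  within-cong (+-#N-∷ hp p (take k P)) (+-#N-∷ hx x (take k X)) (+-#N-∷ hq q (take k Q))

isBasisFrom≡between : ∀ hp hx hq P Q X → length X ≡ length P → length Q ≡ length P →
  isBasisFrom hp hx hq P Q X ≡ between hp hx hq P Q X
isBasisFrom≡between hp hx hq [] [] [] _ _ =
  cong₂ _∧_ (trans (∧-identityʳ _) (withinAt-zero hp hx hq [] [] []))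
            (cong₂ (λ m n → does (m ≟ n)) (+-identityʳ hx) (+-identityʳ hp))
isBasisFrom≡between hp hx hq (p ∷ P) (q ∷ Q) (x ∷ X) |X|≡|P| |Q|≡|P| = begin
    all g (upTo (suc (suc (length P)))) ∧ does ((hx + #N (x ∷ X)) ≟ (hp + #N (p ∷ P)))
  ≡⟨ cong₂ _∧_ (all-upTo-suc g (suc (length P)))
               (cong₂ (λ m n → does (m ≟ n)) (+-#N-∷ hx x X) (+-#N-∷ hp p P)) ⟩
    (g 0 ∧ all (g ∘ suc) (upTo (suc (length P)))) ∧ does ((hx′ + #N X) ≟ (hp′ + #N P))
  ≡⟨ cong₂ (λ b c → (b ∧ c) ∧ does ((hx′ + #N X) ≟ (hp′ + #N P)))
           (withinAt-zero hp hx hq (p ∷ P) (q ∷ Q) (x ∷ X))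
           (cong and (map-cong (withinAt-suc hp hx hq p P q Q x X) (upTo (suc (length P))))) ⟩
    (within hp hx hq ∧ all (withinAt hp′ hx′ hq′ P Q X) (upTo (suc (length P))))
      ∧ does ((hx′ + #N X) ≟ (hp′ + #N P))
  ≡⟨ ∧-assoc (within hp hx hq) _ _ ⟩
    within hp hx hq ∧ isBasisFrom hp′ hx′ hq′ P Q X
  ≡⟨ cong (within hp hx hq ∧_)
          (isBasisFrom≡between hp′ hx′ hq′ P Q X (suc-injective |X|≡|P|) (suc-injective |Q|≡|P|)) ⟩
    between hp hx hq (p ∷ P) (q ∷ Q) (x ∷ X) ∎
  where
  g   = withinAt hp hx hq (p ∷ P) (q ∷ Q) (x ∷ X)
  hp′ = heightAfter p hp
  hx′ = heightAfter x hx
  hq′ = heightAfter q hq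
isBasisFrom≡between hp hx hq []      []      (x ∷ X) ()     _
isBasisFrom≡between hp hx hq []      (q ∷ Q) X       _      ()
isBasisFrom≡between hp hx hq (p ∷ P) []      X       _      ()
isBasisFrom≡between hp hx hq (p ∷ P) (q ∷ Q) []      ()     _

does-isBasis? : ∀ P Q B → length Q ≡ length P → does (isBasis? P Q B) ≡ between 0 0 0 P Q (toList B)
does-isBasis? P Q B |Q|≡|P| = begin
    does (isBasis? P Q B)
  ≡⟨ cong (does (#N X ≟ #N P) ∧_)
          (does-all? (λ k → (heightAt P k ≤? heightAt X k) ×-dec (heightAt X k ≤? heightAt Q k))
                     (upTo (suc (length P)))) ⟩
    does (#N X ≟ #N P) ∧ all (withinAt 0 0 0 P Q X) (upTo (suc (length P)))
  ≡⟨ ∧-comm (does (#N X ≟ #N P)) _ ⟩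
    isBasisFrom 0 0 0 P Q X
  ≡⟨ isBasisFrom≡between 0 0 0 P Q X (length-toList B) |Q|≡|P| ⟩
    between 0 0 0 P Q X ∎
  where X = toList B

countWords : ℕ → (List Bool → Bool) → ℕ
countWords n g = sum (map (λ B → bit (g (toList B))) (allSubsets n))

countWords-suc : ∀ n g →
  countWords (suc n) g ≡ countWords n (g ∘ (false ∷_)) + countWords n (g ∘ (true ∷_))
countWords-suc n g = sum-map-concatMap-pair _ (false ∷ᵥ_) (true ∷ᵥ_) (allSubsets n)

countWords-guard : ∀ n c g h →
  countWords n (λ X → c ∧ g X) + countWords n (λ X → c ∧ h X)
  ≡ (if c then countWords n g + countWords n h else 0)
countWords-guard n true  g h = refl
countWords-guard n false g h =
  cong₂ _+_ (sum-map-zero (λ _ → refl) (allSubsets n)) (sum-map-zero (λ _ → refl) (allSubsets n))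

corridorPaths : ℕ → ℕ → ℕ → List Bool → List Bool → ℕ
corridorPaths hp hx hq []      []      = bit (within hp hx hq ∧ does (hx ≟ hp))
corridorPaths hp hx hq (p ∷ P) (q ∷ Q) =
  if within hp hx hq
  then corridorPaths (heightAfter p hp) hx       (heightAfter q hq) P Q
     + corridorPaths (heightAfter p hp) (suc hx) (heightAfter q hq) P Q
  else 0
corridorPaths _ _ _ _ _ = 0

countWords-between : ∀ hp hx hq P Q → length Q ≡ length P →
  countWords (length P) (between hp hx hq P Q) ≡ corridorPaths hp hx hq P Q
countWords-between hp hx hq [] [] _ = +-identityʳ _
countWords-between hp hx hq (p ∷ P) (q ∷ Q) |Q|≡|P| = begin
    countWords (suc (length P)) (between hp hx hq (p ∷ P) (q ∷ Q))
  ≡⟨ countWords-suc (length P) (between hp hx hq (p ∷ P) (q ∷ Q)) ⟩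
    countWords (length P) (λ X → within hp hx hq ∧ between hp′ hx hq′ P Q X)
      + countWords (length P) (λ X → within hp hx hq ∧ between hp′ (suc hx) hq′ P Q X)
  ≡⟨ countWords-guard (length P) (within hp hx hq)
                      (between hp′ hx hq′ P Q) (between hp′ (suc hx) hq′ P Q) ⟩
    (if within hp hx hq
     then countWords (length P) (between hp′ hx hq′ P Q)
        + countWords (length P) (between hp′ (suc hx) hq′ P Q)
     else 0)
  ≡⟨ cong (λ n → if within hp hx hq then n else 0)
          (cong₂ _+_ (countWords-between hp′ hx hq′ P Q (suc-injective |Q|≡|P|))
                     (countWords-between hp′ (suc hx) hq′ P Q (suc-injective |Q|≡|P|))) ⟩
    corridorPaths hp hx hq (p ∷ P) (q ∷ Q) ∎
  where
  hp′ = heightAfter p hp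
  hq′ = heightAfter q hq
countWords-between hp hx hq []      (q ∷ Q) ()
countWords-between hp hx hq (p ∷ P) []      ()

T11≡corridorPaths : ∀ P Q → length Q ≡ length P → T11 P Q ≡ corridorPaths 0 0 0 P Q
T11≡corridorPaths P Q |Q|≡|P| = begin
    length (filter (isBasis? P Q) (allSubsets (length P)))
  ≡⟨ length-filter≡sum (isBasis? P Q) (allSubsets (length P)) ⟩
    sum (map (λ B → bit (does (isBasis? P Q B))) (allSubsets (length P)))
  ≡⟨ cong sum (map-cong (λ B → cong bit (does-isBasis? P Q B |Q|≡|P|)) (allSubsets (length P))) ⟩
    countWords (length P) (between 0 0 0 P Q)
  ≡⟨ countWords-between 0 0 0 P Q |Q|≡|P| ⟩
    corridorPaths 0 0 0 P Q ∎

corridorPaths-shift : ∀ hp hx hq P Q →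
  corridorPaths (suc hp) (suc hx) (suc hq) P Q ≡ corridorPaths hp hx hq P Q
corridorPaths-shift hp hx hq [] [] = cong (λ b → bit (b ∧ does (hx ≟ hp))) (within-suc hp hx hq)
corridorPaths-shift hp hx hq (p ∷ P) (q ∷ Q)
  rewrite within-suc hp hx hq | heightAfter-suc p hp | heightAfter-suc q hq
        | corridorPaths-shift (heightAfter p hp) hx       (heightAfter q hq) P Q
        | corridorPaths-shift (heightAfter p hp) (suc hx) (heightAfter q hq) P Q = refl
corridorPaths-shift hp hx hq []      (q ∷ Q) = refl
corridorPaths-shift hp hx hq (p ∷ P) []      = refl

corridorPaths-blocked : ∀ {hp hx hq} P Q → within hp hx hq ≡ false → corridorPaths hp hx hq P Q ≡ 0
corridorPaths-blocked {hp} {hx} [] [] blocked = cong (λ b → bit (b ∧ does (hx ≟ hp))) blocked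
corridorPaths-blocked {hp} {hx} {hq} (p ∷ P) (q ∷ Q) blocked =
  cong (λ b → if b then corridorPaths (heightAfter p hp) hx (heightAfter q hq) P Q
                      + corridorPaths (heightAfter p hp) (suc hx) (heightAfter q hq) P Q
              else 0) blocked
corridorPaths-blocked []      (q ∷ Q) _ = refl
corridorPaths-blocked (p ∷ P) []      _ = refl

step : ℕ → ℕ × ℕ → ℕ × ℕ
step a (u , v) = (a ∸ 1) * u + v , u

transfer : List ℕ → ℕ × ℕ → ℕ × ℕ
transfer as t = foldr step t as

total : ℕ × ℕ → ℕ
total (u , v) = u + v

snakeCount : List ℕ → ℕ
snakeCount as = total (transfer as (1 , 1))

-- Once its first step is taken, a lattice path in the diagram of a snake sits at
-- the lower or at the upper corner of a square of the ribbon; the two components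
-- count the ways to finish from each corner, w being the moves between squares.
ribbonPaths : List Bool → ℕ × ℕ
ribbonPaths []          = 1 , 1
ribbonPaths (false ∷ w) = let l , u = ribbonPaths w in l + u , u
ribbonPaths (true  ∷ w) = let l , u = ribbonPaths w in l , l + u

snakeCorridor : ℕ → ℕ → ℕ → List Bool → ℕ
snakeCorridor hp hx hq w = corridorPaths hp hx hq (w ++ true ∷ []) (w ++ false ∷ [])

snakeCorridor-lower : ∀ w → snakeCorridor 0 0 1 w ≡ proj₁ (ribbonPaths w)
snakeCorridor-upper : ∀ w → snakeCorridor 0 1 1 w ≡ proj₂ (ribbonPaths w)

snakeCorridor-lower []          = refl
snakeCorridor-lower (false ∷ w) = cong₂ _+_ (snakeCorridor-lower w) (snakeCorridor-upper w)
snakeCorridor-lower (true  ∷ w) =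
  cong₂ _+_ (corridorPaths-blocked (w ++ true ∷ []) (w ++ false ∷ []) refl)
            (trans (corridorPaths-shift 0 0 1 (w ++ true ∷ []) (w ++ false ∷ [])) (snakeCorridor-lower w))

snakeCorridor-upper []          = refl
snakeCorridor-upper (false ∷ w) = begin
    snakeCorridor 0 1 1 w + snakeCorridor 0 2 1 w
  ≡⟨ cong (snakeCorridor 0 1 1 w +_) (corridorPaths-blocked (w ++ true ∷ []) (w ++ false ∷ []) refl) ⟩
    snakeCorridor 0 1 1 w + 0
  ≡⟨ +-identityʳ _ ⟩
    snakeCorridor 0 1 1 w
  ≡⟨ snakeCorridor-upper w ⟩
    proj₂ (ribbonPaths w) ∎
snakeCorridor-upper (true  ∷ w) =
  cong₂ _+_ (trans (corridorPaths-shift 0 0 1 (w ++ true ∷ []) (w ++ false ∷ [])) (snakeCorridor-lower w))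
            (trans (corridorPaths-shift 0 1 1 (w ++ true ∷ []) (w ++ false ∷ [])) (snakeCorridor-upper w))

rightRun upRun : ℕ → ℕ × ℕ → ℕ × ℕ
rightRun m (l , u) = m * u + l , u
upRun    m (l , u) = l , m * l + u

ribbonPaths-rightRun : ∀ m w → ribbonPaths (replicate m false ++ w) ≡ rightRun m (ribbonPaths w)
ribbonPaths-rightRun zero    w = refl
ribbonPaths-rightRun (suc m) w =
  trans (cong (λ (l , u) → l + u , u) (ribbonPaths-rightRun m w))
        (cong (_, proj₂ (ribbonPaths w)) (rearrange m (proj₁ (ribbonPaths w)) (proj₂ (ribbonPaths w))))
  where
  rearrange : ∀ m l u → (m * u + l) + u ≡ suc m * u + l
  rearrange = solve-∀

ribbonPaths-upRun : ∀ m w → ribbonPaths (replicate m true ++ w) ≡ upRun m (ribbonPaths w)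
ribbonPaths-upRun zero    w = refl
ribbonPaths-upRun (suc m) w =
  trans (cong (λ (l , u) → l , l + u) (ribbonPaths-upRun m w))
        (cong (proj₁ (ribbonPaths w) ,_) (sym (+-assoc (proj₁ (ribbonPaths w)) _ _)))

-- A turn of the ribbon swaps the roles of its two corners.
ribbonPaths-horizontal : ∀ as → ribbonPaths (snakeMovesFrom true  as) ≡ transfer as (1 , 1)
ribbonPaths-vertical   : ∀ as → ribbonPaths (snakeMovesFrom false as) ≡ swap (transfer as (1 , 1))

ribbonPaths-horizontal []       = refl
ribbonPaths-horizontal (a ∷ as) =
  trans (ribbonPaths-rightRun (a ∸ 1) _) (cong (rightRun (a ∸ 1)) (ribbonPaths-vertical as))

ribbonPaths-vertical []       = refl
ribbonPaths-vertical (a ∷ as) =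
  trans (ribbonPaths-upRun (a ∸ 1) _) (cong (upRun (a ∸ 1)) (ribbonPaths-horizontal as))

snakeT11≡snakeCount : ∀ as → snakeT11 as ≡ snakeCount as
snakeT11≡snakeCount as = begin
    snakeT11 as
  ≡⟨ T11≡corridorPaths (snakeLower as) (snakeUpper as)
                       (cong suc (trans (length-++ w) (sym (length-++ w)))) ⟩
    snakeCorridor 0 0 1 w + snakeCorridor 0 1 1 w
  ≡⟨ cong₂ _+_ (snakeCorridor-lower w) (snakeCorridor-upper w) ⟩
    total (ribbonPaths w)
  ≡⟨ cong total (ribbonPaths-horizontal as) ⟩
    snakeCount as ∎
  where w = snakeMoves as

weight : List ℕ → List Bool → ℕ
weight as b = bit (does (noAdjOnes? b)) * fibTerm as b

fibStart : List ℕ → Bool → ℕ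
fibStart as c = sum (map (λ s → weight as (c ∷ s)) (bitsOf (length as)))

weight-00 : ∀ a as s → weight (a ∷ as) (false ∷ false ∷ s) ≡ (a ∸ 1) * weight as (false ∷ s)
weight-00 a as s = rearrange (bit (does (noAdjOnes? (false ∷ s)))) (a ∸ 1) (fibTerm as (false ∷ s))
  where
  rearrange : ∀ c m t → c * ((m * 1) * t) ≡ m * (c * t)
  rearrange = solve-∀

weight-01 : ∀ a as s → weight (a ∷ as) (false ∷ true ∷ s) ≡ weight as (true ∷ s)
weight-01 a as s = cong (bit (does (noAdjOnes? (true ∷ s))) *_) (+-identityʳ (fibTerm as (true ∷ s)))

weight-10 : ∀ a as s → weight (a ∷ as) (true ∷ false ∷ s) ≡ weight as (false ∷ s)
weight-10 a as s = cong (bit (does (noAdjOnes? (false ∷ s))) *_) (+-identityʳ (fibTerm as (false ∷ s)))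

fibSum≡fibStart : ∀ as → fibSum as ≡ fibStart as false + fibStart as true
fibSum≡fibStart as =
  trans (sum-map-filter noAdjOnes? (fibTerm as) (bitsOf (suc (length as))))
        (sum-map-concatMap-pair (weight as) (false ∷_) (true ∷_) (bitsOf (length as)))

fibStart-false : ∀ as → fibStart as false ≡ proj₁ (transfer as (1 , 1))
fibStart-true  : ∀ as → fibStart as true  ≡ proj₂ (transfer as (1 , 1))

fibStart-false []       = refl
fibStart-false (a ∷ as) = begin
    fibStart (a ∷ as) false
  ≡⟨ sum-map-concatMap-pair (λ s → weight (a ∷ as) (false ∷ s)) (false ∷_) (true ∷_) bs ⟩
    sum (map (λ s → weight (a ∷ as) (false ∷ false ∷ s)) bs)
      + sum (map (λ s → weight (a ∷ as) (false ∷ true ∷ s)) bs)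
  ≡⟨ cong₂ _+_ (cong sum (map-cong (weight-00 a as) bs)) (cong sum (map-cong (weight-01 a as) bs)) ⟩
    sum (map (λ s → (a ∸ 1) * weight as (false ∷ s)) bs) + fibStart as true
  ≡⟨ cong (_+ fibStart as true) (sum-map-scale (a ∸ 1) (λ s → weight as (false ∷ s)) bs) ⟩
    (a ∸ 1) * fibStart as false + fibStart as true
  ≡⟨ cong₂ (λ u v → (a ∸ 1) * u + v) (fibStart-false as) (fibStart-true as) ⟩
    proj₁ (transfer (a ∷ as) (1 , 1)) ∎
  where bs = bitsOf (length as)

fibStart-true []       = refl
fibStart-true (a ∷ as) = begin
    fibStart (a ∷ as) true
  ≡⟨ sum-map-concatMap-pair (λ s → weight (a ∷ as) (true ∷ s)) (false ∷_) (true ∷_) bs ⟩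
    sum (map (λ s → weight (a ∷ as) (true ∷ false ∷ s)) bs)
      + sum (map (λ s → weight (a ∷ as) (true ∷ true ∷ s)) bs)
  ≡⟨ cong₂ _+_ (cong sum (map-cong (weight-10 a as) bs)) (sum-map-zero (λ _ → refl) bs) ⟩
    fibStart as false + 0
  ≡⟨ +-identityʳ _ ⟩
    fibStart as false
  ≡⟨ fibStart-false as ⟩
    proj₂ (transfer (a ∷ as) (1 , 1)) ∎
  where bs = bitsOf (length as)

fibSum≡snakeCount : ∀ as → fibSum as ≡ snakeCount as
fibSum≡snakeCount as = trans (fibSum≡fibStart as) (cong₂ _+_ (fibStart-false as) (fibStart-true as))

combine : ℕ → ℕ × ℕ → ℕ × ℕ → ℕ × ℕ
combine c (u , v) (u′ , v′) = u + c * u′ , v + c * v′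

step-combine : ∀ a c s t → step a (combine c s t) ≡ combine c (step a s) (step a t)
step-combine a c (u , v) (u′ , v′) = cong (_, u + c * u′) (distribute (a ∸ 1) c u v u′ v′)
  where
  distribute : ∀ m c u v u′ v′ → m * (u + c * u′) + (v + c * v′) ≡ (m * u + v) + c * (m * u′ + v′)
  distribute = solve-∀

transfer-combine : ∀ as c s t →
  transfer as (combine c s t) ≡ combine c (transfer as s) (transfer as t)
transfer-combine []       c s t = refl
transfer-combine (a ∷ as) c s t =
  trans (cong (step a) (transfer-combine as c s t)) (step-combine a c (transfer as s) (transfer as t))

total-combine : ∀ c s t → total (combine c s t) ≡ total s + c * total t
total-combine c (u , v) (u′ , v′) = distribute c u v u′ v′
  where
  distribute : ∀ c u v u′ v′ → (u + c * u′) + (v + c * v′) ≡ (u + v) + c * (u′ + v′)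
  distribute = solve-∀

-- M(x) M(y) (1,1) = M(x) (1,1) + (y - 1) M(x - 1) (1,1),
-- as M(y) (1,1) = (1,1) + (y - 1) (1,0) and M(x) (1,0) = M(x - 1) (1,1) once x ≥ 2.
transfer-twoSteps : ∀ {x} y → 2 ≤ x →
  transfer (x ∷ y ∷ []) (1 , 1)
  ≡ combine (y ∸ 1) (transfer (x ∷ []) (1 , 1)) (transfer (x ∸ 1 ∷ []) (1 , 1))
transfer-twoSteps {suc (suc k)} y (s≤s (s≤s z≤n)) =
  cong₂ _,_ (rearrange k (y ∸ 1)) (+-comm ((y ∸ 1) * 1) 1)
  where
  rearrange : ∀ k c → suc k * (c * 1 + 1) + 1 ≡ (suc k * 1 + 1) + c * (k * 1 + 1)
  rearrange = solve-∀

snakeCount-++ : ∀ as bs → snakeCount (as ++ bs) ≡ total (transfer as (transfer bs (1 , 1)))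
snakeCount-++ as bs = cong total (foldr-++ step (1 , 1) as bs)

snakeCount-recurrence : ∀ as x y → 2 ≤ x →
  snakeCount (as ++ x ∷ y ∷ [])
  ≡ snakeCount (as ++ x ∷ []) + (y ∸ 1) * snakeCount (as ++ x ∸ 1 ∷ [])
snakeCount-recurrence as x y 2≤x = begin
    snakeCount (as ++ x ∷ y ∷ [])
  ≡⟨ snakeCount-++ as (x ∷ y ∷ []) ⟩
    total (transfer as (transfer (x ∷ y ∷ []) (1 , 1)))
  ≡⟨ cong (total ∘ transfer as) (transfer-twoSteps y 2≤x) ⟩
    total (transfer as (combine (y ∸ 1) s t))
  ≡⟨ cong total (transfer-combine as (y ∸ 1) s t) ⟩
    total (combine (y ∸ 1) (transfer as s) (transfer as t))
  ≡⟨ total-combine (y ∸ 1) (transfer as s) (transfer as t) ⟩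
    total (transfer as s) + (y ∸ 1) * total (transfer as t)
  ≡⟨ sym (cong₂ (λ m n → m + (y ∸ 1) * n)
                (snakeCount-++ as (x ∷ [])) (snakeCount-++ as (x ∸ 1 ∷ []))) ⟩
    snakeCount (as ++ x ∷ []) + (y ∸ 1) * snakeCount (as ++ x ∸ 1 ∷ []) ∎
  where
  s = transfer (x ∷ []) (1 , 1)
  t = transfer (x ∸ 1 ∷ []) (1 , 1)

-- M(1) swaps the two coordinates, which fixes (1,1).
snakeCount-++-1 : ∀ as → snakeCount (as ++ 1 ∷ []) ≡ snakeCount as
snakeCount-++-1 as = snakeCount-++ as (1 ∷ [])

snakeCount-reducedSeq : ∀ as x → snakeCount (reducedSeq as x) ≡ snakeCount (as ++ x ∸ 1 ∷ [])
snakeCount-reducedSeq []       x = refl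
snakeCount-reducedSeq (a ∷ as) x with x ≟ 2
... | yes refl = sym (snakeCount-++-1 (a ∷ as))
... | no  _    = refl

penultimate≥2 : ∀ as x y → ValidSnakeSeq (as ++ x ∷ y ∷ []) → ¬ (as ≡ [] × x ≡ 1) → 2 ≤ x
penultimate≥2 []       0             y (valid () _) _
penultimate≥2 []       1             y _            not-S[1,y] = ⊥-elim (not-S[1,y] (refl , refl))
penultimate≥2 []       (suc (suc k)) y _            _          = s≤s (s≤s z≤n)
penultimate≥2 (a ∷ as) x             y (valid _ as≥2) _        = head (++⁻ʳ as as≥2)

proposition3p6 : ((as : List ℕ) → ValidSnakeSeq as → snakeT11 as ≡ fibSum as)
    × ((as : List ℕ) (x y : ℕ) → ValidSnakeSeq (as ++ x ∷ y ∷ [])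
    → ¬ ((as ≡ []) × (x ≡ 1))
    → snakeT11 (as ++ x ∷ y ∷ [])
    ≡ snakeT11 (as ++ x ∷ []) + (y ∸ 1) * snakeT11 (reducedSeq as x))
proposition3p6 =
  (λ as _ → trans (snakeT11≡snakeCount as) (sym (fibSum≡snakeCount as))) ,
  λ as x y valid nonTrivial → begin
    snakeT11 (as ++ x ∷ y ∷ [])
  ≡⟨ snakeT11≡snakeCount (as ++ x ∷ y ∷ []) ⟩
    snakeCount (as ++ x ∷ y ∷ [])
  ≡⟨ snakeCount-recurrence as x y (penultimate≥2 as x y valid nonTrivial) ⟩
    snakeCount (as ++ x ∷ []) + (y ∸ 1) * snakeCount (as ++ x ∸ 1 ∷ [])
  ≡⟨ cong₂ (λ m n → m + (y ∸ 1) * n)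
           (sym (snakeT11≡snakeCount (as ++ x ∷ [])))
           (trans (sym (snakeCount-reducedSeq as x)) (sym (snakeT11≡snakeCount (reducedSeq as x)))) ⟩
    snakeT11 (as ++ x ∷ []) + (y ∸ 1) * snakeT11 (reducedSeq as x) ∎
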